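{- Let $m$ be a positive integer, and let $c_1 = 5\cdot 2^{m+2}+3$ (binary $101\underbrace{0\cdots0}_{m}11$) and $c_2=3\cdot 2^{m+1}+1$ (binary $11\underbrace{0\cdots0}_{m}1$). Then $\ell(c_1)=m+6$ and $\ell(c_2)=m+4$, and there exists an addition chain for $c_1$ of length $m+7$ which contains $c_2$.
   Context: An addition chain for a positive integer $N$ is a sequence of integers $1=a_0<a_1<\cdots<a_r=N$ such that each $a_k$ ($k\geq 1$) equals $a_i+a_j$ for some $i,j<k$ (with $i=j$ allowed); $r$ is its length. $\ell(N)$ denotes the smallest length of an addition chain for $N$. -}

module Defs where

open import Data.Nat using (ℕ; zero; suc; _+_; _*_; _^_; _≤_; _<_)
open import Data.Fin using (Fin; toℕ; inject₁; fromℕ)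
import Data.Fin as Fin
open import Data.Product using (Σ; ∃; _×_; ∃-syntax)
open import Relation.Binary.PropositionalEquality using (_≡_)
open import Relation.Nullary using (¬_)

record AdditionChain (r : ℕ) : Set where
  field
    elem      : Fin (suc r) → ℕ
    start     : elem Fin.zero ≡ 1
    increasing : (k : Fin r) → elem (inject₁ k) < elem (Fin.suc k)
    sumStep   : (k : Fin r) → ∃[ i ] ∃[ j ]
                  (toℕ i ≤ toℕ k × toℕ j ≤ toℕ k ×
                   elem (Fin.suc k) ≡ elem i + elem j)

last : ∀ {r} → AdditionChain r → ℕ
last {r} c = AdditionChain.elem c (fromℕ r)

ChainFor : ℕ → ℕ → Set
ChainFor N r = Σ (AdditionChain r) (λ c → last c ≡ N)

ℓ≡ : ℕ → ℕ → Set
ℓ≡ N r = ChainFor N r × (∀ s → s < r → ¬ ChainFor N s)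

Contains : ∀ {r} → AdditionChain r → ℕ → Set
Contains {r} c x = ∃[ k ] AdditionChain.elem c k ≡ x

-- The upper bounds are explicit chains: 1, 2, 3, 5, then m + 2 doublings and + 3 for c₁;
-- 1, 2, 3, then m + 1 doublings and + 1 for c₂; and, writing P = 2^(m-1),
-- 1, 2, …, P, 2P, 3P, 6P, 12P, c₂ = 12P + 1, c₂ + 2P, 2c₂ + 4P, c₁ = 3c₂ + 4P.
-- The lower bounds are Knuth's argument that ν(N) ≥ 3 forces ℓ(N) ≥ λ(N) + 2. A chain of
-- length r ending at or above 2^(r-1) has 2^(k-1) ≤ a_k ≤ 2^k for every k (since a_{k+1} ≤ 2a_k),
-- and then every a_k is 2^(k-1) plus zero or a power of two: by induction on k, writing
-- a_{k+1} = a_i + a_j with i ≤ j and splitting on whether j < k, i = j = k, or i < j = k, and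
-- in the last case on the shape of a_k and on whether i = k - 1. Both c₁ = 2^(m+4) + (4·2^m + 3) and c₂ = 2^(m+2) + (2·2^m + 1)
-- have an odd remainder larger than 1, which rules out chains of length λ(N) + 1, while chains
-- of length at most λ(N) cannot go beyond 2^λ(N).

module Submission where

open import Defs
open import Data.Nat using (ℕ; zero; suc; _+_; _*_; _^_; _≤_; _<_; z≤n; s≤s; _<?_; _≤?_)
open import Data.Nat.Properties
open import Data.Nat.Tactic.RingSolver using (solve-∀)
open import Data.Fin using (Fin; toℕ; inject₁; fromℕ; fromℕ<)
import Data.Fin as Fin
open import Data.Fin.Properties using (toℕ<n; toℕ-fromℕ<; fromℕ<-toℕ; toℕ-inject₁; toℕ-fromℕ)
open import Data.Product using (Σ; ∃-syntax; _×_; _,_; proj₁)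
open import Data.Sum using (_⊎_; inj₁; inj₂)
open import Relation.Binary.PropositionalEquality
open import Relation.Nullary using (¬_; yes; no)
open import Relation.Nullary.Negation using (contradiction)
open import Relation.Binary.Definitions using (tri<; tri≈; tri>)

-- Addition chains indexed by ℕ rather than Fin, with the last element in the type;
-- the entries a n with n > r carry no meaning.
record Chain (r t : ℕ) : Set where
  field
    a      : ℕ → ℕ
    a-zero : a 0 ≡ 1
    a-last : a r ≡ t
    a-<    : ∀ n → n < r → a n < a (suc n)
    a-sum  : ∀ n → n < r → ∃[ i ] ∃[ j ] (i ≤ n × j ≤ n × a (suc n) ≡ a i + a j)

open Chain public

infix 4 _∈_

record _∈_ {r t} (x : ℕ) (c : Chain r t) : Set where
  constructor at
  field
    position   : ℕ
    position≤r : position ≤ r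
    a-position : a c position ≡ x

relabel : ∀ {r t t′} → Chain r t → t ≡ t′ → Chain r t′
relabel c t≡t′ = record
  { a = a c ; a-zero = a-zero c ; a-last = trans (a-last c) t≡t′ ; a-< = a-< c ; a-sum = a-sum c }

∈-relabel : ∀ {r t t′ x} {c : Chain r t} {t≡t′ : t ≡ t′} → x ∈ c → x ∈ relabel c t≡t′
∈-relabel (at n n≤r eq) = at n n≤r eq

module _ {r t} (c : Chain r t) where

  a-mono : ∀ {i j} → i ≤ j → j ≤ r → a c i ≤ a c j
  a-mono {j = zero}  z≤n _ = ≤-refl
  a-mono {i} {suc j} i≤1+j 1+j≤r with m≤n⇒m<n∨m≡n i≤1+j
  ... | inj₁ (s≤s i≤j) = ≤-trans (a-mono i≤j (<⇒≤ 1+j≤r)) (<⇒≤ (a-< c j 1+j≤r))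
  ... | inj₂ refl      = ≤-refl

  ∈⇒positive : ∀ {x} → x ∈ c → 0 < x
  ∈⇒positive (at n n≤r refl) = subst (_≤ a c n) (a-zero c) (a-mono z≤n n≤r)

  one-∈ : 1 ∈ c
  one-∈ = at 0 z≤n (a-zero c)

  last-∈ : t ∈ c
  last-∈ = at r ≤-refl (a-last c)

toAdditionChain : ∀ {r t} → Chain r t → AdditionChain r
toAdditionChain {r} c = record
  { elem       = λ k → a c (toℕ k)
  ; start      = a-zero c
  ; increasing = λ k → subst (λ n → a c n < a c (suc (toℕ k))) (sym (toℕ-inject₁ k))
                             (a-< c (toℕ k) (toℕ<n k))
  ; sumStep    = sumStep
  }
  where
  index : ∀ {n} {k : Fin r} → n ≤ toℕ k → Fin (suc r)
  index {k = k} n≤k = fromℕ< (s≤s (≤-trans n≤k (<⇒≤ (toℕ<n k))))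

  sumStep : (k : Fin r) → ∃[ i ] ∃[ j ] (toℕ i ≤ toℕ k × toℕ j ≤ toℕ k ×
                                          a c (suc (toℕ k)) ≡ a c (toℕ i) + a c (toℕ j))
  sumStep k with a-sum c (toℕ k) (toℕ<n k)
  ... | i , j , i≤k , j≤k , eq =
    index i≤k , index j≤k ,
    subst (_≤ toℕ k) (sym (toℕ-fromℕ< _)) i≤k ,
    subst (_≤ toℕ k) (sym (toℕ-fromℕ< _)) j≤k ,
    trans eq (sym (cong₂ (λ i j → a c i + a c j) (toℕ-fromℕ< _) (toℕ-fromℕ< _)))

toChainFor : ∀ {r N} → Chain r N → ChainFor N r
toChainFor {r} c = toAdditionChain c , trans (cong (a c) (toℕ-fromℕ r)) (a-last c)

∈⇒Contains : ∀ {r t x} (c : Chain r t) → x ∈ c → Contains (toAdditionChain c) x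
∈⇒Contains c (at n n≤r eq) = fromℕ< (s≤s n≤r) , trans (cong (a c) (toℕ-fromℕ< _)) eq

module _ {r} (ac : AdditionChain r) where
  open AdditionChain ac

  private
    clamp : ℕ → Fin (suc r)
    clamp n with n <? suc r
    ... | yes n<1+r = fromℕ< n<1+r
    ... | no _      = Fin.zero

    value : ℕ → ℕ
    value n = elem (clamp n)

    value-toℕ : ∀ k → value (toℕ k) ≡ elem k
    value-toℕ k with toℕ k <? suc r
    ... | yes k<1+r = cong elem (fromℕ<-toℕ k k<1+r)
    ... | no k≮1+r  = contradiction (toℕ<n k) k≮1+r

    byFin : {P : ℕ → Set} → (∀ (k : Fin r) → P (toℕ k)) → ∀ n → n < r → P n
    byFin {P} f n n<r = subst P (toℕ-fromℕ< n<r) (f (fromℕ< n<r))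

    value-< : ∀ (k : Fin r) → value (toℕ k) < value (suc (toℕ k))
    value-< k = subst₂ _<_
      (sym (trans (cong value (sym (toℕ-inject₁ k))) (value-toℕ (inject₁ k))))
      (sym (value-toℕ (Fin.suc k)))
      (increasing k)

    value-sum : ∀ (k : Fin r) → ∃[ i ] ∃[ j ] (i ≤ toℕ k × j ≤ toℕ k ×
                                                value (suc (toℕ k)) ≡ value i + value j)
    value-sum k with sumStep k
    ... | i , j , i≤k , j≤k , eq =
      toℕ i , toℕ j , i≤k , j≤k ,
      trans (value-toℕ (Fin.suc k)) (trans eq (sym (cong₂ _+_ (value-toℕ i) (value-toℕ j))))

  fromAdditionChain : Chain r (last ac)
  fromAdditionChain = record
    { a      = value
    ; a-zero = trans (value-toℕ Fin.zero) start
    ; a-last = trans (cong value (sym (toℕ-fromℕ r))) (value-toℕ (fromℕ r))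
    ; a-<    = byFin value-<
    ; a-sum  = byFin value-sum
    }

extendSeq : (ℕ → ℕ) → ℕ → ℕ → ℕ → ℕ
extendSeq f r v n with n ≤? r
... | yes _ = f n
... | no _  = v

extendSeq-≤ : ∀ f {r} v {n} → n ≤ r → extendSeq f r v n ≡ f n
extendSeq-≤ f {r} v {n} n≤r with n ≤? r
... | yes _   = refl
... | no n≰r  = contradiction n≤r n≰r

extendSeq-suc : ∀ f r v → extendSeq f r v (suc r) ≡ v
extendSeq-suc f r v with suc r ≤? r
... | yes 1+r≤r = contradiction 1+r≤r (<-irrefl refl)
... | no _      = refl

singleton : Chain 0 1
singleton = record
  { a = λ _ → 1 ; a-zero = refl ; a-last = refl ; a-< = λ _ () ; a-sum = λ _ () }

extend : ∀ {r t y} (c : Chain r t) → y ∈ c → Chain (suc r) (t + y)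
extend {r} {t} {y} c y∈c@(at ny ny≤r a-ny) = record
  { a      = a′
  ; a-zero = trans (old z≤n) (a-zero c)
  ; a-last = extendSeq-suc (a c) r (t + y)
  ; a-<    = a′-<
  ; a-sum  = a′-sum
  }
  where
  a′ = extendSeq (a c) r (t + y)

  old : ∀ {n} → n ≤ r → a′ n ≡ a c n
  old = extendSeq-≤ (a c) (t + y)

  a′-< : ∀ n → n < suc r → a′ n < a′ (suc n)
  a′-< n n<1+r with m<1+n⇒m<n∨m≡n n<1+r
  ... | inj₁ n<r  = subst₂ _<_ (sym (old (<⇒≤ n<r))) (sym (old n<r)) (a-< c n n<r)
  ... | inj₂ refl = subst₂ _<_ (sym (trans (old ≤-refl) (a-last c))) (sym (extendSeq-suc (a c) r (t + y)))
                           (m<m+n t (∈⇒positive c y∈c))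

  a′-sum : ∀ n → n < suc r → ∃[ i ] ∃[ j ] (i ≤ n × j ≤ n × a′ (suc n) ≡ a′ i + a′ j)
  a′-sum n n<1+r with m<1+n⇒m<n∨m≡n n<1+r
  ... | inj₁ n<r with a-sum c n n<r
  ...   | i , j , i≤n , j≤n , eq = i , j , i≤n , j≤n ,
    trans (old n<r) (trans eq (sym (cong₂ _+_ (old (≤-trans i≤n (<⇒≤ n<r)))
                                               (old (≤-trans j≤n (<⇒≤ n<r))))))
  a′-sum n n<1+r | inj₂ refl = r , ny , ≤-refl , ny≤r ,
    trans (extendSeq-suc (a c) r (t + y))
          (sym (cong₂ _+_ (trans (old ≤-refl) (a-last c)) (trans (old ny≤r) a-ny)))

∈-extend : ∀ {r t x y} {c : Chain r t} {y∈c : y ∈ c} → x ∈ c → x ∈ extend c y∈c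
∈-extend {c = c} (at n n≤r eq) = at n (m≤n⇒m≤1+n n≤r) (trans (extendSeq-≤ (a c) _ n≤r) eq)

double : ∀ {r t} (c : Chain r t) → Chain (suc r) (t + t)
double c = extend c (last-∈ c)

double^ : ∀ {r t} k → Chain r t → Chain (k + r) (2 ^ k * t)
double^ {t = t} zero    c = relabel c (sym (*-identityˡ t))
double^ {t = t} (suc k) c = relabel (double (double^ k c)) (twice (2 ^ k) t)
  where
  twice : ∀ p t → p * t + p * t ≡ 2 * p * t
  twice = solve-∀

∈-double^ : ∀ {r t x} k {c : Chain r t} → x ∈ c → x ∈ double^ k c
∈-double^ zero    x∈c = ∈-relabel x∈c
∈-double^ (suc k) x∈c = ∈-relabel (∈-extend (∈-double^ k x∈c))

c₁-chain : ∀ m → ChainFor (5 * 2 ^ (m + 2) + 3) (m + 6)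
c₁-chain m =
  subst (ChainFor _) (length m) (toChainFor (relabel s₅ (cong (_+ 3) (*-comm (2 ^ (m + 2)) 5))))
  where
  s₁ : Chain 1 2
  s₁ = double singleton
  s₂ : Chain 2 3
  s₂ = extend s₁ (one-∈ s₁)
  s₃ : Chain 3 5
  s₃ = extend s₂ (∈-extend (last-∈ s₁))
  s₄ : Chain (m + 2 + 3) (2 ^ (m + 2) * 5)
  s₄ = double^ (m + 2) s₃
  s₅ : Chain (suc (m + 2 + 3)) (2 ^ (m + 2) * 5 + 3)
  s₅ = extend s₄ (∈-double^ (m + 2) (∈-extend (last-∈ s₂)))

  length : ∀ m → suc (m + 2 + 3) ≡ m + 6
  length = solve-∀

c₂-chain : ∀ m → ChainFor (3 * 2 ^ (m + 1) + 1) (m + 4)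
c₂-chain m =
  subst (ChainFor _) (length m) (toChainFor (relabel s₄ (cong (_+ 1) (*-comm (2 ^ (m + 1)) 3))))
  where
  s₁ : Chain 1 2
  s₁ = double singleton
  s₂ : Chain 2 3
  s₂ = extend s₁ (one-∈ s₁)
  s₃ : Chain (m + 1 + 2) (2 ^ (m + 1) * 3)
  s₃ = double^ (m + 1) s₂
  s₄ : Chain (suc (m + 1 + 2)) (2 ^ (m + 1) * 3 + 1)
  s₄ = extend s₃ (one-∈ s₃)

  length : ∀ m → suc (m + 1 + 2) ≡ m + 4
  length = solve-∀

c₁-chain-through-c₂ : ∀ m → 1 ≤ m →
  Σ (ChainFor (5 * 2 ^ (m + 2) + 3) (m + 7)) (λ cf → Contains (proj₁ cf) (3 * 2 ^ (m + 1) + 1))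
c₁-chain-through-c₂ (suc k) _ =
  subst (λ r → Σ (ChainFor c₁ r) (λ cf → Contains (proj₁ cf) c₂)) (length k)
        (toChainFor (relabel s₇ c₁-value) , ∈⇒Contains (relabel s₇ c₁-value) (∈-relabel c₂∈s₇))
  where
  P  = 2 ^ k
  c₁ = 5 * 2 ^ (suc k + 2) + 3
  c₂ = 3 * 2 ^ (suc k + 1) + 1

  c₂-value : 4 * (P + P + P) + 1 ≡ c₂
  c₂-value = begin
    4 * (P + P + P) + 1    ≡⟨ expand P ⟩
    3 * (2 * (P * 2)) + 1  ≡⟨ cong (λ x → 3 * (2 * x) + 1) (^-distribˡ-+-* 2 k 1) ⟨
    c₂                     ∎
    where
    open ≡-Reasoning
    expand : ∀ p → 4 * (p + p + p) + 1 ≡ 3 * (2 * (p * 2)) + 1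
    expand = solve-∀

  c₁-value : c₂ + (P + P) + (c₂ + (P + P)) + c₂ ≡ c₁
  c₁-value = begin
    c₂ + (P + P) + (c₂ + (P + P)) + c₂ ≡⟨ regroup c₂ P ⟩
    3 * c₂ + 4 * P                     ≡⟨ cong (λ x → 3 * x + 4 * P) c₂-value ⟨
    3 * (4 * (P + P + P) + 1) + 4 * P  ≡⟨ expand P ⟩
    5 * (2 * (P * 4)) + 3              ≡⟨ cong (λ x → 5 * (2 * x) + 3) (^-distribˡ-+-* 2 k 2) ⟨
    c₁                                 ∎
    where
    open ≡-Reasoning
    regroup : ∀ x p → x + (p + p) + (x + (p + p)) + x ≡ 3 * x + 4 * p
    regroup = solve-∀
    expand : ∀ p → 3 * (4 * (p + p + p) + 1) + 4 * p ≡ 5 * (2 * (p * 4)) + 3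
    expand = solve-∀

  s₀ : Chain (k + 0) P
  s₀ = relabel (double^ k singleton) (*-identityʳ P)
  s₁ : Chain (1 + (k + 0)) (P + P)
  s₁ = double s₀
  s₂ : Chain (2 + (k + 0)) (P + P + P)
  s₂ = extend s₁ (∈-extend (last-∈ s₀))
  s₃ : Chain (4 + (k + 0)) (4 * (P + P + P))
  s₃ = double^ 2 s₂
  s₄ : Chain (5 + (k + 0)) c₂
  s₄ = relabel (extend s₃ (one-∈ s₃)) c₂-value
  s₅ : Chain (6 + (k + 0)) (c₂ + (P + P))
  s₅ = extend s₄ (∈-relabel (∈-extend (∈-double^ 2 (∈-extend (last-∈ s₁)))))
  s₆ : Chain (7 + (k + 0)) (c₂ + (P + P) + (c₂ + (P + P)))
  s₆ = double s₅
  s₇ : Chain (8 + (k + 0)) (c₂ + (P + P) + (c₂ + (P + P)) + c₂)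
  s₇ = extend s₆ (∈-extend (∈-extend (last-∈ s₄)))

  c₂∈s₇ : c₂ ∈ s₇
  c₂∈s₇ = ∈-extend (∈-extend (∈-extend (last-∈ s₄)))

  length : ∀ k → 8 + (k + 0) ≡ suc k + 7
  length = solve-∀

Pow2OrZero : ℕ → Set
Pow2OrZero w = w ≡ 0 ⊎ ∃[ e ] w ≡ 2 ^ e

pow2OrZero-double : ∀ {w} → Pow2OrZero w → Pow2OrZero (2 * w)
pow2OrZero-double (inj₁ refl)      = inj₁ refl
pow2OrZero-double (inj₂ (e , refl)) = inj₂ (suc e , refl)

pow2OrZero-half : ∀ {w} → Pow2OrZero (2 * w) → Pow2OrZero w
pow2OrZero-half {zero}  _                     = inj₁ refl
pow2OrZero-half {suc w} (inj₂ (zero , 2w≡1))  = contradiction 2w≡1 (even≢odd (suc w) 0)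
pow2OrZero-half {suc w} (inj₂ (suc e , 2w≡2ᵉ⁺¹)) = inj₂ (e , *-cancelˡ-≡ (suc w) (2 ^ e) 2 2w≡2ᵉ⁺¹)

-- The omitted cases, 1 + 2m ≡ 0 and 1 + 2m ≡ 1, are refuted by unification.
odd-¬pow2OrZero : ∀ {m} → 0 < m → ¬ Pow2OrZero (1 + 2 * m)
odd-¬pow2OrZero {suc m} _ (inj₂ (suc e , eq)) = even≢odd (2 ^ e) (suc m) (sym eq)

pow2OrZero-≤⇒≡∨half : ∀ {w k} → Pow2OrZero w → w ≤ 2 ^ k → w ≡ 2 ^ k ⊎ 2 * w ≤ 2 ^ k
pow2OrZero-≤⇒≡∨half (inj₁ refl) _ = inj₂ z≤n
pow2OrZero-≤⇒≡∨half {k = k} (inj₂ (e , refl)) 2ᵉ≤2ᵏ with <-cmp e k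
... | tri< e<k _ _ = inj₂ (^-monoʳ-≤ 2 e<k)
... | tri≈ _ refl _ = inj₁ refl
... | tri> _ _ k<e = contradiction 2ᵉ≤2ᵏ (<⇒≱ (^-monoʳ-< 2 (s≤s (s≤s z≤n)) k<e))

pow2OrZero-sum : ∀ {u w k} → Pow2OrZero u → Pow2OrZero w → u ≤ 2 ^ k → w ≤ 2 ^ k → 2 ^ k ≤ u + w →
                 ∃[ x ] (Pow2OrZero x × x ≤ 2 ^ k × u + w ≡ 2 ^ k + x)
pow2OrZero-sum {u} {w} {k} pu pw u≤2ᵏ w≤2ᵏ 2ᵏ≤u+w
  with pow2OrZero-≤⇒≡∨half {k = k} pu u≤2ᵏ | pow2OrZero-≤⇒≡∨half {k = k} pw w≤2ᵏ
... | inj₁ refl | _         = w , pw , w≤2ᵏ , refl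
... | inj₂ _    | inj₁ refl = u , pu , u≤2ᵏ , +-comm u w
... | inj₂ 2u≤2ᵏ | inj₂ 2w≤2ᵏ =
  0 , inj₁ refl , z≤n , trans (≤-antisym u+w≤2ᵏ 2ᵏ≤u+w) (sym (+-identityʳ (2 ^ k)))
  where
  u+w≤2ᵏ : u + w ≤ 2 ^ k
  u+w≤2ᵏ = *-cancelˡ-≤ 2 (begin
    2 * (u + w)     ≡⟨ *-distribˡ-+ 2 u w ⟩
    2 * u + 2 * w   ≤⟨ +-mono-≤ 2u≤2ᵏ 2w≤2ᵏ ⟩
    2 ^ k + 2 ^ k   ≡⟨ cong (2 ^ k +_) (+-identityʳ (2 ^ k)) ⟨
    2 * 2 ^ k       ∎)
    where open ≤-Reasoning

-- 2v = 2ᵏ + w: for k > 0, v = 2ᵏ⁻¹ + w/2 has at most two one-bits and 2ᵏ⁻¹ ≤ v ≤ 2ᵏ;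
-- doubling v lets the case k = 0, v = 1 (w = 1) fit the same pattern.
TwoBitShape : ℕ → ℕ → Set
TwoBitShape k v = ∃[ w ] (Pow2OrZero w × w ≤ 2 ^ k × 2 * v ≡ 2 ^ k + w)

shape-one : TwoBitShape 0 1
shape-one = 1 , inj₂ (0 , refl) , ≤-refl , refl

shape-squeeze : ∀ {k v} → 2 ^ k ≤ 2 * v → 2 * v ≤ 2 ^ k → TwoBitShape k v
shape-squeeze {k} lo hi = 0 , inj₁ refl , z≤n , trans (≤-antisym hi lo) (sym (+-identityʳ (2 ^ k)))

shape-double : ∀ {k v} → TwoBitShape k v → TwoBitShape (suc k) (v + v)
shape-double {k} {v} (w , pw , w≤2ᵏ , 2v≡) = 2 * w , pow2OrZero-double pw , *-monoʳ-≤ 2 w≤2ᵏ , (begin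
  2 * (v + v)       ≡⟨ cong (2 *_) (cong (v +_) (+-identityʳ v)) ⟨
  2 * (2 * v)       ≡⟨ cong (2 *_) 2v≡ ⟩
  2 * (2 ^ k + w)   ≡⟨ *-distribˡ-+ 2 (2 ^ k) w ⟩
  2 ^ suc k + 2 * w ∎)
  where open ≡-Reasoning

shape-pow+pow : ∀ {i k} → i ≤ k → TwoBitShape (suc k) (2 ^ i + 2 ^ k)
shape-pow+pow {i} {k} i≤k = 2 ^ suc i , inj₂ (suc i , refl) , ^-monoʳ-≤ 2 (s≤s i≤k) ,
  trans (*-distribˡ-+ 2 (2 ^ i) (2 ^ k)) (+-comm (2 ^ suc i) (2 ^ suc k))

shape-small+top : ∀ {n y x u} → 2 * y ≤ 2 ^ n → 2 * x ≡ 2 ^ suc n + u → 2 * u ≤ 2 ^ suc n →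
                  2 ^ suc (suc n) ≤ 2 * (y + x) → TwoBitShape (suc (suc n)) (y + x)
shape-small+top {n} {y} {x} {u} 2y≤2ⁿ 2x≡ 2u≤2ⁿ⁺¹ lo = shape-squeeze {suc (suc n)} {y + x} lo (begin
  2 * (y + x)               ≡⟨ *-distribˡ-+ 2 y x ⟩
  2 * y + 2 * x             ≡⟨ cong (2 * y +_) 2x≡ ⟩
  2 * y + (2 ^ suc n + u)   ≤⟨ +-mono-≤ 2y≤2ⁿ (+-monoʳ-≤ (2 ^ suc n) (*-cancelˡ-≤ 2 2u≤2ⁿ⁺¹)) ⟩
  2 ^ n + (2 * 2 ^ n + 2 ^ n) ≡⟨ regroup (2 ^ n) ⟩
  2 ^ suc (suc n)           ∎)
  where
  open ≤-Reasoning
  regroup : ∀ q → q + (2 * q + q) ≡ 2 * (2 * q)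
  regroup = solve-∀

shape-shape+top : ∀ {n y x u} → TwoBitShape n y → 2 * x ≡ 2 ^ suc n + u → Pow2OrZero u →
                  2 * u ≤ 2 ^ suc n → 2 ^ suc (suc n) ≤ 2 * (y + x) → TwoBitShape (suc (suc n)) (y + x)
shape-shape+top {n} {y} {x} {u} (w , pw , w≤2ⁿ , 2y≡) 2x≡ pu 2u≤2ⁿ⁺¹ lo =
  shape (pow2OrZero-sum {k = n} pw pu w≤2ⁿ (*-cancelˡ-≤ 2 2u≤2ⁿ⁺¹) 2ⁿ≤w+u)
  where
  open ≡-Reasoning
  Q = 2 ^ n

  2[y+x]≡ : 2 * (y + x) ≡ 3 * Q + (w + u)
  2[y+x]≡ = begin
    2 * (y + x)          ≡⟨ *-distribˡ-+ 2 y x ⟩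
    2 * y + 2 * x        ≡⟨ cong₂ _+_ 2y≡ 2x≡ ⟩
    Q + w + (2 * Q + u)  ≡⟨ regroup Q w u ⟩
    3 * Q + (w + u)      ∎
    where
    regroup : ∀ q w u → q + w + (2 * q + u) ≡ 3 * q + (w + u)
    regroup = solve-∀

  2ⁿ≤w+u : Q ≤ w + u
  2ⁿ≤w+u = +-cancelˡ-≤ (3 * Q) Q (w + u) (subst₂ _≤_ (four Q) 2[y+x]≡ lo)
    where
    four : ∀ q → 2 * (2 * q) ≡ 3 * q + q
    four = solve-∀

  shape : ∃[ z ] (Pow2OrZero z × z ≤ Q × w + u ≡ Q + z) → TwoBitShape (suc (suc n)) (y + x)
  shape (z , pz , z≤2ⁿ , w+u≡) =
    z , pz , ≤-trans z≤2ⁿ (^-monoʳ-≤ 2 (≤-trans (n≤1+n n) (n≤1+n (suc n)))) , (begin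
    2 * (y + x)      ≡⟨ 2[y+x]≡ ⟩
    3 * Q + (w + u)  ≡⟨ cong (3 * Q +_) w+u≡ ⟩
    3 * Q + (Q + z)  ≡⟨ regroup Q z ⟩
    2 * (2 * Q) + z  ∎)
    where
    regroup : ∀ q z → 3 * q + (q + z) ≡ 2 * (2 * q) + z
    regroup = solve-∀

module _ {r t} (c : Chain r t) where
  private
    A = a c

  a-suc≤2*a : ∀ {n} → n < r → A (suc n) ≤ 2 * A n
  a-suc≤2*a {n} n<r with a-sum c n n<r
  ... | i , j , i≤n , j≤n , eq = begin
    A (suc n)      ≡⟨ eq ⟩
    A i + A j      ≤⟨ +-mono-≤ (a-mono c i≤n (<⇒≤ n<r)) (a-mono c j≤n (<⇒≤ n<r)) ⟩
    A n + A n      ≡⟨ cong (A n +_) (+-identityʳ (A n)) ⟨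
    2 * A n        ∎
    where open ≤-Reasoning

  a≤2^ : ∀ {n} → n ≤ r → A n ≤ 2 ^ n
  a≤2^ {zero}  _   = ≤-reflexive (a-zero c)
  a≤2^ {suc n} n<r = ≤-trans (a-suc≤2*a n<r) (*-monoʳ-≤ 2 (a≤2^ (<⇒≤ n<r)))

  lower-bound-descends : ∀ {i k} → i ≤ k → k ≤ r → 2 ^ k ≤ 2 * A k → 2 ^ i ≤ 2 * A i
  lower-bound-descends {k = zero} z≤n _ lo = lo
  lower-bound-descends {i} {suc k} i≤1+k 1+k≤r lo with m≤n⇒m<n∨m≡n i≤1+k
  ... | inj₁ (s≤s i≤k) = lower-bound-descends i≤k (<⇒≤ 1+k≤r)
                           (*-cancelˡ-≤ 2 (≤-trans lo (*-monoʳ-≤ 2 (a-suc≤2*a 1+k≤r))))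
  ... | inj₂ refl      = lo

  power-descends : ∀ {i k} → i ≤ k → k ≤ r → A k ≡ 2 ^ k → A i ≡ 2 ^ i
  power-descends {k = zero} z≤n _ eq = eq
  power-descends {i} {suc k} i≤1+k 1+k≤r eq with m≤n⇒m<n∨m≡n i≤1+k
  ... | inj₁ (s≤s i≤k) = power-descends i≤k k≤r (≤-antisym (a≤2^ k≤r)
                           (*-cancelˡ-≤ 2 (subst (_≤ 2 * A k) eq (a-suc≤2*a 1+k≤r))))
    where k≤r = <⇒≤ 1+k≤r
  ... | inj₂ refl      = eq

  ordered-sum : ∀ n → n < r → ∃[ i ] ∃[ j ] (i ≤ j × j ≤ n × A (suc n) ≡ A i + A j)
  ordered-sum n n<r with a-sum c n n<r
  ... | i , j , i≤n , j≤n , eq with ≤-total i j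
  ...   | inj₁ i≤j = i , j , i≤j , j≤n , eq
  ...   | inj₂ j≤i = j , i , j≤i , i≤n , trans eq (+-comm (A i) (A j))

  ShapesUpTo : ℕ → Set
  ShapesUpTo k = ∀ {n} → n ≤ k → TwoBitShape n (A n)

  shape-below+top : ∀ {i k} → i < k → k < r → ShapesUpTo k →
                    2 ^ suc k ≤ 2 * (A i + A k) → TwoBitShape (suc k) (A i + A k)
  shape-below+top {i} {suc n} (s≤s i≤n) 1+n<r shapes lo with shapes ≤-refl
  ... | u , pu , u≤2ⁿ⁺¹ , 2x≡ with pow2OrZero-≤⇒≡∨half {k = suc n} pu u≤2ⁿ⁺¹
  ...   | inj₁ refl = subst (TwoBitShape (suc (suc n))) (sym (cong₂ _+_ Aᵢ≡ Aₖ≡))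
                            (shape-pow+pow (m≤n⇒m≤1+n i≤n))
    where
    Aₖ≡ : A (suc n) ≡ 2 ^ suc n
    Aₖ≡ = *-cancelˡ-≡ _ _ 2 (trans 2x≡ (cong (2 ^ suc n +_) (sym (+-identityʳ (2 ^ suc n)))))
    Aᵢ≡ : A i ≡ 2 ^ i
    Aᵢ≡ = power-descends (m≤n⇒m≤1+n i≤n) (<⇒≤ 1+n<r) Aₖ≡
  ...   | inj₂ 2u≤2ⁿ⁺¹ with m≤n⇒m<n∨m≡n i≤n
  ...     | inj₁ i<n  = shape-small+top {n} {A i} 2Aᵢ≤2ⁿ 2x≡ 2u≤2ⁿ⁺¹ lo
    where
    2Aᵢ≤2ⁿ : 2 * A i ≤ 2 ^ n
    2Aᵢ≤2ⁿ = ≤-trans (*-monoʳ-≤ 2 (a≤2^ (≤-trans (<⇒≤ i<n) (≤-trans (n≤1+n n) (<⇒≤ 1+n<r)))))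
                     (^-monoʳ-≤ 2 i<n)
  ...     | inj₂ refl = shape-shape+top {n} {A n} (shapes (n≤1+n n)) 2x≡ pu 2u≤2ⁿ⁺¹ lo

  shape-of-sum : ∀ {i j k} → i ≤ j → j ≤ k → k < r → ShapesUpTo k →
                 2 ^ suc k ≤ 2 * (A i + A j) → TwoBitShape (suc k) (A i + A j)
  shape-of-sum {i} {j} {k} i≤j j≤k k<r shapes lo with m≤n⇒m<n∨m≡n j≤k
  ... | inj₁ j<k = shape-squeeze {suc k} {A i + A j} lo (*-monoʳ-≤ 2 (begin
    A i + A j       ≤⟨ +-mono-≤ (≤-trans (a-mono c i≤j j≤r) (a≤2^ j≤r)) (a≤2^ j≤r) ⟩
    2 ^ j + 2 ^ j   ≡⟨ cong (2 ^ j +_) (+-identityʳ (2 ^ j)) ⟨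
    2 ^ suc j       ≤⟨ ^-monoʳ-≤ 2 j<k ⟩
    2 ^ k           ∎))
    where
    open ≤-Reasoning
    j≤r = ≤-trans j≤k (<⇒≤ k<r)
  ... | inj₂ refl with m≤n⇒m<n∨m≡n i≤j
  ...   | inj₁ i<k  = shape-below+top i<k k<r shapes lo
  ...   | inj₂ refl = shape-double {k} {A k} (shapes ≤-refl)

  shape-suc : ∀ {k} → k < r → ShapesUpTo k → 2 ^ suc k ≤ 2 * A (suc k) → TwoBitShape (suc k) (A (suc k))
  shape-suc {k} k<r shapes lo with ordered-sum k k<r
  ... | i , j , i≤j , j≤k , eq = subst (TwoBitShape (suc k)) (sym eq)
    (shape-of-sum i≤j j≤k k<r shapes (subst (λ v → 2 ^ suc k ≤ 2 * v) eq lo))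

  shapes-up-to : 2 ^ r ≤ 2 * t → ∀ k → k ≤ r → ShapesUpTo k
  shapes-up-to _ zero _ z≤n = subst (TwoBitShape 0) (sym (a-zero c)) shape-one
  shapes-up-to lo (suc k) 1+k≤r n≤1+k with m≤n⇒m<n∨m≡n n≤1+k
  ... | inj₁ (s≤s n≤k) = shapes-up-to lo k (<⇒≤ 1+k≤r) n≤k
  ... | inj₂ refl = shape-suc 1+k≤r (shapes-up-to lo k (<⇒≤ 1+k≤r))
    (lower-bound-descends 1+k≤r ≤-refl (subst (λ v → 2 ^ r ≤ 2 * v) (sym (a-last c)) lo))

  last-shape : 2 ^ r ≤ 2 * t → TwoBitShape r t
  last-shape lo = subst (TwoBitShape r) (a-last c) (shapes-up-to lo r ≤-refl ≤-refl)

no-short-chain : ∀ {N p z} → N ≡ 2 ^ p + z → ¬ Pow2OrZero z → ∀ s → s < 2 + p → ¬ ChainFor N s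
no-short-chain {N} {p} {z} N≡ ¬pz s s<2+p (ac , last≡N) with m≤n⇒m<n∨m≡n (≤-pred s<2+p)
... | inj₁ (s≤s s≤p) =
  <⇒≱ 2ᵖ<N (≤-trans (subst (_≤ 2 ^ s) (a-last chain) (a≤2^ chain ≤-refl)) (^-monoʳ-≤ 2 s≤p))
  where
  chain = relabel (fromAdditionChain ac) (trans last≡N N≡)
  2ᵖ<N : 2 ^ p < 2 ^ p + z
  2ᵖ<N = m<m+n (2 ^ p) (n≢0⇒n>0 (λ z≡0 → ¬pz (inj₁ z≡0)))
... | inj₂ refl with last-shape chain (*-monoʳ-≤ 2 (m≤m+n (2 ^ p) z))
  where chain = relabel (fromAdditionChain ac) (trans last≡N N≡)
...   | w , pw , _ , 2N≡ = ¬pz (pow2OrZero-half (subst Pow2OrZero w≡2z pw))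
  where
  w≡2z : w ≡ 2 * z
  w≡2z = +-cancelˡ-≡ (2 ^ suc p) w (2 * z) (trans (sym 2N≡) (*-distribˡ-+ 2 (2 ^ p) z))

ℓ-c₁ : ∀ m → ℓ≡ (5 * 2 ^ (m + 2) + 3) (m + 6)
ℓ-c₁ m = c₁-chain m , λ s s<m+6 →
  no-short-chain split (odd-¬pow2OrZero {1 + 2 * 2 ^ m} (s≤s z≤n)) s (subst (s <_) (length m) s<m+6)
  where
  split : 5 * 2 ^ (m + 2) + 3 ≡ 2 ^ (m + 4) + (1 + 2 * (1 + 2 * 2 ^ m))
  split = begin
    5 * 2 ^ (m + 2) + 3                   ≡⟨ cong (λ x → 5 * x + 3) (^-distribˡ-+-* 2 m 2) ⟩
    5 * (2 ^ m * 4) + 3                   ≡⟨ regroup (2 ^ m) ⟩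
    2 ^ m * 16 + (1 + 2 * (1 + 2 * 2 ^ m)) ≡⟨ cong (_+ (1 + 2 * (1 + 2 * 2 ^ m))) (^-distribˡ-+-* 2 m 4) ⟨
    2 ^ (m + 4) + (1 + 2 * (1 + 2 * 2 ^ m)) ∎
    where
    open ≡-Reasoning
    regroup : ∀ q → 5 * (q * 4) + 3 ≡ q * 16 + (1 + 2 * (1 + 2 * q))
    regroup = solve-∀
  length : ∀ m → m + 6 ≡ 2 + (m + 4)
  length = solve-∀

ℓ-c₂ : ∀ m → ℓ≡ (3 * 2 ^ (m + 1) + 1) (m + 4)
ℓ-c₂ m = c₂-chain m , λ s s<m+4 →
  no-short-chain split (odd-¬pow2OrZero (m^n>0 2 m)) s (subst (s <_) (length m) s<m+4)
  where
  split : 3 * 2 ^ (m + 1) + 1 ≡ 2 ^ (m + 2) + (1 + 2 * 2 ^ m)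
  split = begin
    3 * 2 ^ (m + 1) + 1          ≡⟨ cong (λ x → 3 * x + 1) (^-distribˡ-+-* 2 m 1) ⟩
    3 * (2 ^ m * 2) + 1          ≡⟨ regroup (2 ^ m) ⟩
    2 ^ m * 4 + (1 + 2 * 2 ^ m)  ≡⟨ cong (_+ (1 + 2 * 2 ^ m)) (^-distribˡ-+-* 2 m 2) ⟨
    2 ^ (m + 2) + (1 + 2 * 2 ^ m) ∎
    where
    open ≡-Reasoning
    regroup : ∀ q → 3 * (q * 2) + 1 ≡ q * 4 + (1 + 2 * q)
    regroup = solve-∀
  length : ∀ m → m + 4 ≡ 2 + (m + 2)
  length = solve-∀

mainTheorem6 : (m : ℕ) → 1 ≤ m →
    ℓ≡ (5 * 2 ^ (m + 2) + 3) (m + 6) ×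
    ℓ≡ (3 * 2 ^ (m + 1) + 1) (m + 4) ×
    Σ (ChainFor (5 * 2 ^ (m + 2) + 3) (m + 7))
      (λ cf → Contains (Σ.proj₁ cf) (3 * 2 ^ (m + 1) + 1))
mainTheorem6 m 1≤m = ℓ-c₁ m , ℓ-c₂ m , c₁-chain-through-c₂ m 1≤m
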